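{- For every integer $n \ge 2$, \[ \chi_2(n) \le \left\lfloor \frac{2n}{3} \right\rfloor + 1 . \]
   Context: For a prime power $q$ and integer $n\ge 1$, $\mathrm{PG}(n-1,q)$ is the projective space whose points are the $1$-dimensional subspaces of $\mathbb{F}_q^n$ and whose lines are the $2$-dimensional subspaces of $\mathbb{F}_q^n$. $\chi_q(n)$ denotes the minimum number of colors needed to color the points of $\mathrm{PG}(n-1,q)$ so that no line is monochromatic (all its points receiving the same color). For $q=2$, points are the nonzero vectors of $\mathbb{F}_2^n$ and lines are the triples $\{x,y,x+y\}$ with $x\ne y$ nonzero. -}

module Defs where

open import Data.Nat using (ℕ; _≤_)
open import Data.Bool using (Bool; false; _xor_)
open import Data.Vec using (Vec; replicate; zipWith)
open import Data.Fin using (Fin)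
open import Data.Product using (Σ; proj₁; _×_; ∃)
open import Relation.Nullary using (¬_)
open import Relation.Binary.PropositionalEquality using (_≡_; _≢_)

F2^ : ℕ → Set
F2^ n = Vec Bool n

zeroVec : ∀ n → F2^ n
zeroVec n = replicate n false

_⊕_ : ∀ {n} → F2^ n → F2^ n → F2^ n
_⊕_ = zipWith _xor_

-- Points of PG(n-1,2): nonzero vectors of F₂ⁿ.
Point : ℕ → Set
Point n = Σ (F2^ n) (λ v → v ≢ zeroVec n)

-- A line of PG(n-1,2) is {x, y, x+y} with x ≠ y nonzero.
-- A colouring c is proper if no line is monochromatic.
ProperColouring : ∀ {n k} → (Point n → Fin k) → Set
ProperColouring {n} c =
  (x y z : Point n) → proj₁ x ≢ proj₁ y → proj₁ z ≡ proj₁ x ⊕ proj₁ y →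
  ¬ (c x ≡ c y × c y ≡ c z)

χ₂≤ : ℕ → ℕ → Set
χ₂≤ n k = Σ (Point n → Fin k) ProperColouring

-- Proper colourings glue: from T on F₂^(1+h) with r + 1 colours and c on F₂^m with k colours
-- one gets a colouring of F₂^(h+m) with r + k colours, i.e. χ₂(a + b − 1) ≤ χ₂(a) + χ₂(b) − 1.
-- Write x = (u, w) with u ∈ F₂^h, w ∈ F₂^m and let s = c(0). If c(w) ≠ s, x keeps the colour c(w);
-- otherwise x gets T(ε(w), u), where ε(w) ∈ F₂ records whether w ≠ 0 and colour 0 of T is
-- identified with s. A monochromatic triple w₁, w₂, w₁ + w₂ of c contains 0 or has w₁ = w₂, so
-- it has colour s and ε is additive on it. Hence a monochromatic line of the glued colouring
-- projects to such a triple of colour s, and then (u, w) ↦ (ε(w), u) maps it to a monochromatic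
-- line of T. Gluing explicit colourings witnessing χ₂(2) ≤ 2 and χ₂(4) ≤ 3 then gives
-- χ₂(n + 1) ≤ χ₂(n) + 1 and χ₂(n + 3) ≤ χ₂(n) + 2.

module Submission where

open import Defs
open import Data.Nat using (ℕ; zero; suc; _≤_; _*_; _/_; _+_)
open import Data.Nat.Properties using (*-distribˡ-+)
open import Data.Nat.DivMod using (+-distrib-/-∣ˡ)
open import Data.Nat.Divisibility using (divides)
open import Data.Bool using (Bool; true; false; not; _xor_)
open import Data.Bool.Properties using (xor-same; xor-identityˡ; xor-identityʳ; xor-assoc)
  renaming (_≟_ to _≟ᵇ_)
open import Data.Vec using ([]; _∷_; _++_; replicate; take; drop; head; tail)
open import Data.Vec.Properties
  using (≡-dec; zipWith-identityˡ; zipWith-identityʳ; zipWith-assoc; take-zipWith; drop-zipWith; take++drop≡id)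
open import Data.Fin using (Fin; zero; suc; join; splitAt; #_) renaming (_≟_ to _≟ᶠ_)
open import Data.Fin.Properties using (splitAt-join)
open import Data.Sum using (_⊎_; inj₁; inj₂)
open import Data.Sum.Properties using (inj₁-injective; inj₂-injective)
open import Data.Product using (Σ; proj₁; proj₂; _×_; _,_)
open import Data.Empty using (⊥; ⊥-elim)
open import Function using (_∘_)
open import Function.Definitions using (Injective)
open import Relation.Binary.Definitions using (DecidableEquality)
open import Relation.Nullary using (¬_; Dec; yes; no; does)
open import Relation.Nullary.Decidable using (map′; ¬?; _×-dec_; _→-dec_; from-yes)
open import Relation.Binary.PropositionalEquality

private
  variable
    A : Set
    n m h r k : ℕ

infix 4 _≟_

_≟_ : DecidableEquality (F2^ n)
_≟_ = ≡-dec _≟ᵇ_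

⊕-identityˡ : (x : F2^ n) → zeroVec n ⊕ x ≡ x
⊕-identityˡ = zipWith-identityˡ xor-identityˡ

⊕-identityʳ : (x : F2^ n) → x ⊕ zeroVec n ≡ x
⊕-identityʳ = zipWith-identityʳ xor-identityʳ

⊕-assoc : (x y z : F2^ n) → (x ⊕ y) ⊕ z ≡ x ⊕ (y ⊕ z)
⊕-assoc = zipWith-assoc xor-assoc

⊕-self : (x : F2^ n) → x ⊕ x ≡ zeroVec n
⊕-self []      = refl
⊕-self (b ∷ x) = cong₂ _∷_ (xor-same b) (⊕-self x)

⊕≡0⇒≡ : {x y : F2^ n} → x ⊕ y ≡ zeroVec n → x ≡ y
⊕≡0⇒≡ {n} {x} {y} x⊕y≡0 = begin
  x                ≡⟨ ⊕-identityʳ x ⟨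
  x ⊕ zeroVec n    ≡⟨ cong (x ⊕_) (⊕-self y) ⟨
  x ⊕ (y ⊕ y)      ≡⟨ ⊕-assoc x y y ⟨
  (x ⊕ y) ⊕ y      ≡⟨ cong (_⊕ y) x⊕y≡0 ⟩
  zeroVec n ⊕ y    ≡⟨ ⊕-identityˡ y ⟩
  y                ∎
  where open ≡-Reasoning

++-replicate : ∀ h (a : A) → replicate h a ++ replicate m a ≡ replicate (h + m) a
++-replicate zero    a = refl
++-replicate (suc h) a = cong (a ∷_) (++-replicate h a)

take-drop-≡0 : ∀ h (x : F2^ (h + m)) → take h x ≡ zeroVec h → drop h x ≡ zeroVec m →
               x ≡ zeroVec (h + m)
take-drop-≡0 {m} h x take≡0 drop≡0 = begin
  x                         ≡⟨ take++drop≡id h x ⟨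
  take h x ++ drop h x      ≡⟨ cong₂ _++_ take≡0 drop≡0 ⟩
  zeroVec h ++ zeroVec m    ≡⟨ ++-replicate h false ⟩
  zeroVec (h + m)           ∎
  where open ≡-Reasoning

nonzero : F2^ n → Bool
nonzero {n} x = not (does (x ≟ zeroVec n))

nonzero-zeroVec : ∀ n → nonzero (zeroVec n) ≡ false
nonzero-zeroVec n with zeroVec n ≟ zeroVec n
... | yes _   = refl
... | no  0≢0 = ⊥-elim (0≢0 refl)

nonzero≡false⇒≡0 : (x : F2^ n) → nonzero x ≡ false → x ≡ zeroVec n
nonzero≡false⇒≡0 {n} x with x ≟ zeroVec n
... | yes x≡0 = λ _ → x≡0
... | no  _   = λ ()

nonzero-⊕ : (x y : F2^ n) → x ≡ zeroVec n ⊎ y ≡ zeroVec n ⊎ x ≡ y →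
            nonzero (x ⊕ y) ≡ nonzero x xor nonzero y
nonzero-⊕ {n} x y (inj₁ refl) = begin
  nonzero (zeroVec n ⊕ y)              ≡⟨ cong nonzero (⊕-identityˡ y) ⟩
  nonzero y                            ≡⟨ cong (_xor nonzero y) (nonzero-zeroVec n) ⟨
  nonzero (zeroVec n) xor nonzero y    ∎
  where open ≡-Reasoning
nonzero-⊕ {n} x y (inj₂ (inj₁ refl)) = begin
  nonzero (x ⊕ zeroVec n)              ≡⟨ cong nonzero (⊕-identityʳ x) ⟩
  nonzero x                            ≡⟨ xor-identityʳ (nonzero x) ⟨
  nonzero x xor false                  ≡⟨ cong (nonzero x xor_) (nonzero-zeroVec n) ⟨
  nonzero x xor nonzero (zeroVec n)    ∎
  where open ≡-Reasoning
nonzero-⊕ {n} x y (inj₂ (inj₂ refl)) = begin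
  nonzero (x ⊕ x)          ≡⟨ cong nonzero (⊕-self x) ⟩
  nonzero (zeroVec n)      ≡⟨ nonzero-zeroVec n ⟩
  false                    ≡⟨ xor-same (nonzero x) ⟨
  nonzero x xor nonzero x  ∎
  where open ≡-Reasoning

Line : F2^ n → F2^ n → Set
Line {n} x y = x ≢ zeroVec n × y ≢ zeroVec n × x ≢ y

Monochromatic : (F2^ n → A) → F2^ n → F2^ n → Set
Monochromatic c x y = c y ≡ c x × c (x ⊕ y) ≡ c x

Proper : (F2^ n → A) → Set
Proper c = ∀ x y → Line x y → ¬ Monochromatic c x y

-- The zero vector is coloured too (so k ≥ 1 even for n = 0); glue relies on its colour.
Colouring : ℕ → ℕ → Set
Colouring n k = Σ (F2^ n → Fin k) Proper

χ₂≤-from-colouring : Colouring n k → χ₂≤ n k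
χ₂≤-from-colouring (c , c-proper) = c ∘ proj₁ , λ where
  (x , x≢0) (y , y≢0) (z , _) x≢y refl (cx≡cy , cy≡cz) →
    c-proper x y (x≢0 , y≢0 , x≢y) (sym cx≡cy , trans (sym cy≡cz) (sym cx≡cy))

proper-∘ : {B : Set} {c : F2^ n → A} {f : A → B} →
           Injective _≡_ _≡_ f → Proper c → Proper (f ∘ c)
proper-∘ f-injective c-proper x y line (e₁ , e₂) =
  c-proper x y line (f-injective e₁ , f-injective e₂)

monochromatic-degenerate : {c : F2^ n → A} → Proper c → ∀ x y → Monochromatic c x y →
                           x ≡ zeroVec n ⊎ y ≡ zeroVec n ⊎ x ≡ y
monochromatic-degenerate {n} c-proper x y mono with x ≟ zeroVec n | y ≟ zeroVec n | x ≟ y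
... | yes x≡0 | _       | _      = inj₁ x≡0
... | no  _   | yes y≡0 | _      = inj₂ (inj₁ y≡0)
... | no  _   | no  _   | yes x≡y = inj₂ (inj₂ x≡y)
... | no  x≢0 | no  y≢0 | no  x≢y = ⊥-elim (c-proper x y (x≢0 , y≢0 , x≢y) mono)

monochromatic⇒colour-of-zero : {c : F2^ n → A} → Proper c → ∀ x y → Monochromatic c x y →
                               c x ≡ c (zeroVec n)
monochromatic⇒colour-of-zero {c = c} c-proper x y mono@(cy≡cx , cx⊕y≡cx)
  with monochromatic-degenerate c-proper x y mono
... | inj₁ refl        = refl
... | inj₂ (inj₁ refl) = sym cy≡cx
... | inj₂ (inj₂ refl) = trans (sym cx⊕y≡cx) (cong c (⊕-self x))

line-image : ∀ {a b} (f : F2^ a → F2^ b) → (∀ x → f x ≡ zeroVec b → x ≡ zeroVec a) →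
             ∀ x y → f (x ⊕ y) ≡ f x ⊕ f y → Line x y → Line (f x) (f y)
line-image {b = b} f f-reflects-0 x y f-additive (x≢0 , y≢0 , x≢y) =
  x≢0 ∘ f-reflects-0 x , y≢0 ∘ f-reflects-0 y , fx≢fy
  where
  fx≢fy : f x ≢ f y
  fx≢fy fx≡fy = x≢y (⊕≡0⇒≡ (f-reflects-0 (x ⊕ y) (begin
    f (x ⊕ y)    ≡⟨ f-additive ⟩
    f x ⊕ f y    ≡⟨ cong (_⊕ f y) fx≡fy ⟩
    f y ⊕ f y    ≡⟨ ⊕-self (f y) ⟩
    zeroVec b    ∎)))
    where open ≡-Reasoning

module Glue {T : F2^ (suc h) → Fin (suc r)} {c : F2^ m → Fin k}
            (T-proper : Proper T) (c-proper : Proper c) where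

  shared : Fin k
  shared = c (zeroVec m)

  embed : Fin (suc r) → Fin r ⊎ Fin k
  embed zero    = inj₂ shared
  embed (suc i) = inj₁ i

  embed-injective : Injective _≡_ _≡_ embed
  embed-injective {zero}  {zero}  _  = refl
  embed-injective {zero}  {suc _} ()
  embed-injective {suc _} {zero}  ()
  embed-injective {suc i} {suc j} eq = cong suc (inj₁-injective eq)

  embed≡inj₂⇒shared : ∀ t {j} → embed t ≡ inj₂ j → j ≡ shared
  embed≡inj₂⇒shared zero refl = refl

  lift : F2^ (h + m) → F2^ (suc h)
  lift x = nonzero (drop h x) ∷ take h x

  colour : F2^ (h + m) → Fin r ⊎ Fin k
  colour x with c (drop h x) ≟ᶠ shared
  ... | yes _ = embed (T (lift x))
  ... | no  _ = inj₂ (c (drop h x))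

  colour-shared : ∀ x → c (drop h x) ≡ shared → colour x ≡ embed (T (lift x))
  colour-shared x cx≡shared with c (drop h x) ≟ᶠ shared
  ... | yes _         = refl
  ... | no  cx≢shared = ⊥-elim (cx≢shared cx≡shared)

  colour-other : ∀ x → c (drop h x) ≢ shared → colour x ≡ inj₂ (c (drop h x))
  colour-other x cx≢shared with c (drop h x) ≟ᶠ shared
  ... | yes cx≡shared = ⊥-elim (cx≢shared cx≡shared)
  ... | no  _         = refl

  colour≡embed : ∀ x {t} → colour x ≡ embed t → c (drop h x) ≡ shared × T (lift x) ≡ t
  colour≡embed x {t} eq with c (drop h x) ≟ᶠ shared
  ... | yes cx≡shared = cx≡shared , embed-injective eq
  ... | no  cx≢shared = ⊥-elim (cx≢shared (embed≡inj₂⇒shared t (sym eq)))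

  colour≡inj₂ : ∀ x {j} → colour x ≡ inj₂ j → j ≢ shared → c (drop h x) ≡ j
  colour≡inj₂ x eq j≢shared with c (drop h x) ≟ᶠ shared
  ... | yes _ = ⊥-elim (j≢shared (embed≡inj₂⇒shared (T (lift x)) eq))
  ... | no  _ = inj₂-injective eq

  drop-⊕ : (x y : F2^ (h + m)) → drop h (x ⊕ y) ≡ drop h x ⊕ drop h y
  drop-⊕ = drop-zipWith {m = h} _xor_

  lift-reflects-0 : ∀ x → lift x ≡ zeroVec (suc h) → x ≡ zeroVec (h + m)
  lift-reflects-0 x lift≡0 =
    take-drop-≡0 h x (cong tail lift≡0) (nonzero≡false⇒≡0 (drop h x) (cong head lift≡0))

  lift-⊕ : (x y : F2^ (h + m)) → Monochromatic c (drop h x) (drop h y) → lift (x ⊕ y) ≡ lift x ⊕ lift y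
  lift-⊕ x y mono = cong₂ _∷_
    (trans (cong nonzero (drop-⊕ x y))
           (nonzero-⊕ _ _ (monochromatic-degenerate c-proper _ _ mono)))
    (take-zipWith {m = h} _xor_ x y)

  colour-proper : Proper colour
  colour-proper x y line (e₁ , e₂) = by-cases (c (drop h x) ≟ᶠ shared)
    where
    by-cases : Dec (c (drop h x) ≡ shared) → ⊥
    by-cases (yes cx≡shared) =
      T-proper (lift x) (lift y) (line-image lift lift-reflects-0 x y (lift-⊕ x y c-mono) line) T-mono
      where
      same : ∀ z → colour z ≡ colour x → c (drop h z) ≡ shared × T (lift z) ≡ T (lift x)
      same z e = colour≡embed z (trans e (colour-shared x cx≡shared))

      c-mono : Monochromatic c (drop h x) (drop h y)
      c-mono = trans (proj₁ (same y e₁)) (sym cx≡shared)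
             , trans (cong c (sym (drop-⊕ x y))) (trans (proj₁ (same (x ⊕ y) e₂)) (sym cx≡shared))

      T-mono : Monochromatic T (lift x) (lift y)
      T-mono = proj₂ (same y e₁) , trans (cong T (sym (lift-⊕ x y c-mono))) (proj₂ (same (x ⊕ y) e₂))
    by-cases (no cx≢shared) = cx≢shared (monochromatic⇒colour-of-zero c-proper _ _ c-mono)
      where
      same : ∀ z → colour z ≡ colour x → c (drop h z) ≡ c (drop h x)
      same z e = colour≡inj₂ z (trans e (colour-other x cx≢shared)) cx≢shared

      c-mono : Monochromatic c (drop h x) (drop h y)
      c-mono = same y e₁ , trans (cong c (sym (drop-⊕ x y))) (same (x ⊕ y) e₂)

join-injective : ∀ r k → Injective _≡_ _≡_ (join r k)
join-injective r k {i} {j} eq = begin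
  i                       ≡⟨ splitAt-join r k i ⟨
  splitAt r (join r k i)  ≡⟨ cong (splitAt r) eq ⟩
  splitAt r (join r k j)  ≡⟨ splitAt-join r k j ⟩
  j                       ∎
  where open ≡-Reasoning

glue : Colouring (suc h) (suc r) → Colouring m k → Colouring (h + m) (r + k)
glue {r = r} {k = k} (T , T-proper) (c , c-proper) =
  join r k ∘ colour , proper-∘ (join-injective r k) colour-proper
  where open Glue T-proper c-proper

all? : {P : F2^ n → Set} → (∀ x → Dec (P x)) → Dec (∀ x → P x)
all? {zero}  P? = map′ (λ p → λ { [] → p }) (λ ∀P → ∀P []) (P? [])
all? {suc n} P? =
  map′ (λ (p , q) → λ { (false ∷ x) → p x ; (true ∷ x) → q x })
       (λ ∀P → ∀P ∘ (false ∷_) , ∀P ∘ (true ∷_))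
       (all? (P? ∘ (false ∷_)) ×-dec all? (P? ∘ (true ∷_)))

proper? : (c : F2^ n → Fin k) → Dec (Proper c)
proper? {n} c = all? λ x → all? λ y → line? x y →-dec ¬? (monochromatic? x y)
  where
  line? : ∀ x y → Dec (Line x y)
  line? x y = ¬? (x ≟ zeroVec n) ×-dec ¬? (y ≟ zeroVec n) ×-dec ¬? (x ≟ y)

  monochromatic? : ∀ x y → Dec (Monochromatic c x y)
  monochromatic? x y = (c y ≟ᶠ c x) ×-dec (c (x ⊕ y) ≟ᶠ c x)

colouring-1 : Colouring 1 1
colouring-1 = c , from-yes (proper? c)
  where
  c : F2^ 1 → Fin 1
  c _ = # 0

colouring-2 : Colouring 2 2
colouring-2 = c , from-yes (proper? c)
  where
  c : F2^ 2 → Fin 2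
  c (false ∷ _) = # 0
  c (true  ∷ _) = # 1

colouring-4 : Colouring 4 3
colouring-4 = c , from-yes (proper? c)
  where
  -- Classes: the cosets of the cubes in (F₂[x]/(x⁴+x³+x²+x+1))ˣ, with (a, b, c, d) read as
  -- a + bx + cx² + dx³.
  c : F2^ 4 → Fin 3
  c (false ∷ false ∷ false ∷ false ∷ []) = # 0
  c (false ∷ false ∷ false ∷ true  ∷ []) = # 0
  c (false ∷ false ∷ true  ∷ false ∷ []) = # 0
  c (false ∷ false ∷ true  ∷ true  ∷ []) = # 1
  c (false ∷ true  ∷ false ∷ false ∷ []) = # 0
  c (false ∷ true  ∷ false ∷ true  ∷ []) = # 2
  c (false ∷ true  ∷ true  ∷ false ∷ []) = # 1
  c (false ∷ true  ∷ true  ∷ true  ∷ []) = # 1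
  c (true  ∷ false ∷ false ∷ false ∷ []) = # 0
  c (true  ∷ false ∷ false ∷ true  ∷ []) = # 2
  c (true  ∷ false ∷ true  ∷ false ∷ []) = # 2
  c (true  ∷ false ∷ true  ∷ true  ∷ []) = # 2
  c (true  ∷ true  ∷ false ∷ false ∷ []) = # 1
  c (true  ∷ true  ∷ false ∷ true  ∷ []) = # 2
  c (true  ∷ true  ∷ true  ∷ false ∷ []) = # 1
  c (true  ∷ true  ∷ true  ∷ true  ∷ []) = # 0

2*[3+m]/3≡2+2*m/3 : ∀ m → (2 * (3 + m)) / 3 ≡ 2 + (2 * m) / 3
2*[3+m]/3≡2+2*m/3 m = begin
  (2 * (3 + m)) / 3  ≡⟨ cong (_/ 3) (*-distribˡ-+ 2 3 m) ⟩
  (6 + 2 * m) / 3    ≡⟨ +-distrib-/-∣ˡ {6} (2 * m) {3} (divides 2 refl) ⟩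
  2 + (2 * m) / 3    ∎
  where open ≡-Reasoning

colouring : ∀ n → Colouring (suc n) ((2 * suc n) / 3 + 1)
colouring 0 = colouring-1
colouring 1 = colouring-2
colouring 2 = glue colouring-2 colouring-2
colouring (suc (suc (suc n))) =
  subst (Colouring (4 + n)) (cong (_+ 1) (sym (2*[3+m]/3≡2+2*m/3 (suc n)))) (glue colouring-4 (colouring n))

theorem1p1 : (n : ℕ) → 2 ≤ n → χ₂≤ n ((2 * n) / 3 + 1)
theorem1p1 (suc n) _ = χ₂≤-from-colouring (colouring n)
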